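{- Let $(L,\vee,\wedge,{}',0,1)$ be a complemented modular lattice, i.e. $(L,\vee,\wedge,0,1)$ is a bounded modular lattice and $'$ is a unary operation on $L$ with $x\vee x'=1$ and $x\wedge x'=0$ for all $x\in L$. Define \[ x\odot y:=(x\vee y')\wedge y,\qquad x\rightarrow y:=(x\wedge y)\vee x' \] for all $x,y\in L$. Then $(L,\vee,\wedge,\odot,\rightarrow,0,1)$ is a divisible left residuated lattice.
   Context: A left residuated lattice is an algebra $(L,\vee,\wedge,\odot,\rightarrow,0,1)$ of type $(2,2,2,2,0,0)$ such that $(L,\vee,\wedge,0,1)$ is a bounded lattice, $x\odot 1=1\odot x=x$ for all $x$, and for all $x,y,z$: $x\odot y\le z$ if and only if $x\le y\rightarrow z$. It is called divisible if $(x\rightarrow y)\odot x=x\wedge y$ for all $x,y$. A lattice is modular if it satisfies $(x\vee y)\wedge(x\vee z)=x\vee(y\wedge(x\vee z))$. The complementation $'$ is not assumed to be antitone or an involution. -}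

module Defs where

open import Level using (Level; suc; _⊔_)
open import Relation.Binary.PropositionalEquality using (_≡_)
open import Algebra.Core using (Op₁; Op₂)
open import Algebra.Lattice.Structures using (IsLattice)
open import Data.Product using (_×_)
open import Function.Bundles using (_⇔_)

record IsBoundedLatticeOps {a} (L : Set a) (_∨_ _∧_ : Op₂ L) (𝟘 𝟙 : L) : Set a where
  field
    isLattice : IsLattice _≡_ _∨_ _∧_
    ∨-identity-𝟘 : ∀ x → (x ∨ 𝟘) ≡ x
    ∧-identity-𝟙 : ∀ x → (x ∧ 𝟙) ≡ x

_≤[_]_ : ∀ {a} {L : Set a} → L → Op₂ L → L → Set a
x ≤[ _∧_ ] y = (x ∧ y) ≡ x

IsModular : ∀ {a} {L : Set a} → Op₂ L → Op₂ L → Set a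
IsModular {L = L} _∨_ _∧_ = ∀ (x y z : L) → ((x ∨ y) ∧ (x ∨ z)) ≡ (x ∨ (y ∧ (x ∨ z)))

-- A complemented modular lattice (L, ∨, ∧, ′, 0, 1); ′ is an arbitrary
-- unary operation with x ∨ x′ = 1 and x ∧ x′ = 0 (not assumed antitone/involutive).
record ComplementedModularLattice a : Set (suc a) where
  field
    Carrier : Set a
    _∨_ _∧_ : Op₂ Carrier
    _′ : Op₁ Carrier
    𝟘 𝟙 : Carrier
    isBounded : IsBoundedLatticeOps Carrier _∨_ _∧_ 𝟘 𝟙
    modular : IsModular _∨_ _∧_
    ∨-complement : ∀ x → (x ∨ (x ′)) ≡ 𝟙
    ∧-complement : ∀ x → (x ∧ (x ′)) ≡ 𝟘

record IsLeftResiduatedLattice {a} (L : Set a) (_∨_ _∧_ _⊙_ _⇒_ : Op₂ L) (𝟘 𝟙 : L) : Set a where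
  field
    isBounded : IsBoundedLatticeOps L _∨_ _∧_ 𝟘 𝟙
    ⊙-identityʳ : ∀ x → (x ⊙ 𝟙) ≡ x
    ⊙-identityˡ : ∀ x → (𝟙 ⊙ x) ≡ x
    residuation : ∀ x y z → ((x ⊙ y) ≤[ _∧_ ] z) ⇔ (x ≤[ _∧_ ] (y ⇒ z))

IsDivisible : ∀ {a} {L : Set a} → Op₂ L → Op₂ L → Op₂ L → Set a
IsDivisible {L = L} _∧_ _⊙_ _⇒_ = ∀ (x y : L) → ((x ⇒ y) ⊙ x) ≡ (x ∧ y)

record IsDivisibleLeftResiduatedLattice {a} (L : Set a) (_∨_ _∧_ _⊙_ _⇒_ : Op₂ L) (𝟘 𝟙 : L) : Set a where
  field
    isLeftResiduatedLattice : IsLeftResiduatedLattice L _∨_ _∧_ _⊙_ _⇒_ 𝟘 𝟙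
    divisible : IsDivisible _∧_ _⊙_ _⇒_

module Ops {a} (M : ComplementedModularLattice a) where
  open ComplementedModularLattice M
  _⊙_ : Op₂ Carrier
  x ⊙ y = (x ∨ (y ′)) ∧ y
  _⇒_ : Op₂ Carrier
  x ⇒ y = (x ∧ y) ∨ (x ′)

-- With y′ a complement of y, modularity makes x ↦ x ∨ y′ and w ↦ w ∧ y
-- mutually inverse order isomorphisms between [0, y] and [y′, 1].  In these
-- terms x ⊙ y is the image of x ∨ y′ in [0, y] and y → z the image of y ∧ z
-- in [y′, 1], so x ⊙ y ≤ z ⇔ x ≤ y → z is transport along the isomorphism,
-- and divisibility is the round trip starting from x ∧ y ∈ [0, x].
module Submission where

open import Defs
open import Algebra.Core using (Op₂)
open import Algebra.Lattice.Bundles using (Lattice)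
open import Algebra.Lattice.Structures using (IsLattice)
import Algebra.Lattice.Properties.Lattice as LatticeProperties
import Relation.Binary.Lattice as OrderTheoretic
import Relation.Binary.Lattice.Properties.JoinSemilattice as JoinProperties
import Relation.Binary.Lattice.Properties.MeetSemilattice as MeetProperties
import Relation.Binary.Reasoning.PartialOrder as ≤-Reasoning
open import Function.Bundles using (_⇔_; mk⇔; module Equivalence)
open import Relation.Binary.PropositionalEquality using (_≡_; sym; trans; cong; module ≡-Reasoning)

module LatticeOrder {a} {L : Set a} {_∨_ _∧_ : Op₂ L}
                    (isLattice : IsLattice _≡_ _∨_ _∧_) where

  lattice : Lattice a a
  lattice = record { isLattice = isLattice }

  orderTheoreticLattice : OrderTheoretic.Lattice a a a
  orderTheoreticLattice = LatticeProperties.∨-∧-orderTheoreticLattice lattice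

  open OrderTheoretic.Lattice orderTheoreticLattice public
    using (_≤_; poset; x≤x∨y; y≤x∨y; x∧y≤x; x∧y≤y; ∧-greatest)
    renaming (refl to ≤-refl)
  open OrderTheoretic.Lattice orderTheoreticLattice using (joinSemilattice; meetSemilattice)
  open JoinProperties joinSemilattice public using (∨-monotonic; x≤y⇒x∨y≈y)
  open MeetProperties meetSemilattice public using (∧-monotonic; y≤x⇒x∧y≈y)

  modular-≤ : IsModular _∨_ _∧_ → ∀ {x z} y → x ≤ z → ((x ∨ y) ∧ z) ≡ (x ∨ (y ∧ z))
  modular-≤ modular {x} {z} y x≤z = begin
    (x ∨ y) ∧ z        ≡⟨ cong ((x ∨ y) ∧_) (sym x∨z≡z) ⟩
    (x ∨ y) ∧ (x ∨ z)  ≡⟨ modular x y z ⟩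
    x ∨ (y ∧ (x ∨ z))  ≡⟨ cong (λ t → x ∨ (y ∧ t)) x∨z≡z ⟩
    x ∨ (y ∧ z)        ∎
    where
    open ≡-Reasoning
    x∨z≡z : (x ∨ z) ≡ z
    x∨z≡z = x≤y⇒x∨y≈y x≤z

module ComplementedModularLatticeProperties {a} (M : ComplementedModularLattice a) where
  open ComplementedModularLattice M
  open IsBoundedLatticeOps isBounded
  open IsLattice isLattice using (∨-comm; ∧-comm; ∨-assoc)
  open LatticeOrder isLattice
  open LatticeProperties lattice using (∨-idem)
  open Ops M

  x≤𝟙 : ∀ x → x ≤ 𝟙
  x≤𝟙 x = sym (∧-identity-𝟙 x)

  𝟙∧x≡x : ∀ x → (𝟙 ∧ x) ≡ x
  𝟙∧x≡x x = y≤x⇒x∧y≈y (x≤𝟙 x)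

  𝟙∨x≡𝟙 : ∀ x → (𝟙 ∨ x) ≡ 𝟙
  𝟙∨x≡𝟙 x = trans (∨-comm 𝟙 x) (x≤y⇒x∨y≈y (x≤𝟙 x))

  ∨′-∧-cancel : ∀ {x y} → x ≤ y → ((x ∨ (y ′)) ∧ y) ≡ x
  ∨′-∧-cancel {x} {y} x≤y = begin
    (x ∨ (y ′)) ∧ y   ≡⟨ modular-≤ modular (y ′) x≤y ⟩
    x ∨ ((y ′) ∧ y)   ≡⟨ cong (x ∨_) (trans (∧-comm (y ′) y) (∧-complement y)) ⟩
    x ∨ 𝟘             ≡⟨ ∨-identity-𝟘 x ⟩
    x                 ∎
    where open ≡-Reasoning

  ∧-∨′-cancel : ∀ {w y} → (y ′) ≤ w → ((w ∧ y) ∨ (y ′)) ≡ w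
  ∧-∨′-cancel {w} {y} y′≤w = begin
    (w ∧ y) ∨ (y ′)   ≡⟨ ∨-comm (w ∧ y) (y ′) ⟩
    (y ′) ∨ (w ∧ y)   ≡⟨ cong ((y ′) ∨_) (∧-comm w y) ⟩
    (y ′) ∨ (y ∧ w)   ≡⟨ sym (modular-≤ modular y y′≤w) ⟩
    ((y ′) ∨ y) ∧ w   ≡⟨ cong (_∧ w) (trans (∨-comm (y ′) y) (∨-complement y)) ⟩
    𝟙 ∧ w             ≡⟨ 𝟙∧x≡x w ⟩
    w                 ∎
    where open ≡-Reasoning

  ⇒-∨′-absorb : ∀ y z → ((y ⇒ z) ∨ (y ′)) ≡ (y ⇒ z)
  ⇒-∨′-absorb y z = trans (∨-assoc (y ∧ z) (y ′) (y ′)) (cong ((y ∧ z) ∨_) (∨-idem (y ′)))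

  ⇒-⊙-cancel : ∀ y z → ((y ⇒ z) ⊙ y) ≡ (y ∧ z)
  ⇒-⊙-cancel y z = trans (cong (_∧ y) (⇒-∨′-absorb y z)) (∨′-∧-cancel (x∧y≤x y z))

  ⊙-identityʳ : ∀ x → (x ⊙ 𝟙) ≡ x
  ⊙-identityʳ x = ∨′-∧-cancel (x≤𝟙 x)

  ⊙-identityˡ : ∀ x → (𝟙 ⊙ x) ≡ x
  ⊙-identityˡ x = trans (cong (_∧ x) (𝟙∨x≡𝟙 (x ′))) (𝟙∧x≡x x)

  residuation-≤ : ∀ x y z → (x ⊙ y) ≤ z ⇔ x ≤ (y ⇒ z)
  residuation-≤ x y z = mk⇔ to from
    where
    open ≤-Reasoning poset
    to : (x ⊙ y) ≤ z → x ≤ (y ⇒ z)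
    to x⊙y≤z = begin
      x                        ≤⟨ x≤x∨y x (y ′) ⟩
      x ∨ (y ′)                ≡⟨ sym (∧-∨′-cancel (y≤x∨y x (y ′))) ⟩
      (x ⊙ y) ∨ (y ′)          ≤⟨ ∨-monotonic x⊙y≤y∧z ≤-refl ⟩
      y ⇒ z                    ∎
      where
      x⊙y≤y∧z : (x ⊙ y) ≤ (y ∧ z)
      x⊙y≤y∧z = ∧-greatest (x∧y≤y (x ∨ (y ′)) y) x⊙y≤z
    from : x ≤ (y ⇒ z) → (x ⊙ y) ≤ z
    from x≤y⇒z = begin
      x ⊙ y                    ≤⟨ ∧-monotonic (∨-monotonic x≤y⇒z ≤-refl) ≤-refl ⟩
      (y ⇒ z) ⊙ y              ≡⟨ ⇒-⊙-cancel y z ⟩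
      y ∧ z                    ≤⟨ x∧y≤y y z ⟩
      z                        ∎

  -- _≤_ is the natural order x ≡ x ∧ y, the symmetric form of _≤[ _∧_ ]_.
  residuation : ∀ x y z → (x ⊙ y) ≤[ _∧_ ] z ⇔ x ≤[ _∧_ ] (y ⇒ z)
  residuation x y z = mk⇔ (λ p → sym (to (sym p))) (λ p → sym (from (sym p)))
    where open Equivalence (residuation-≤ x y z)

theorem3 : ∀ {a} (M : ComplementedModularLattice a) →
    IsDivisibleLeftResiduatedLattice (ComplementedModularLattice.Carrier M) (ComplementedModularLattice._∨_ M) (ComplementedModularLattice._∧_ M) (Ops._⊙_ M) (Ops._⇒_ M) (ComplementedModularLattice.𝟘 M) (ComplementedModularLattice.𝟙 M)
theorem3 M = record
  { isLeftResiduatedLattice = record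
    { isBounded   = isBounded
    ; ⊙-identityʳ = ⊙-identityʳ
    ; ⊙-identityˡ = ⊙-identityˡ
    ; residuation = residuation
    }
  ; divisible = ⇒-⊙-cancel
  }
  where
  open ComplementedModularLattice M using (isBounded)
  open ComplementedModularLatticeProperties M
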